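{- Let $m\geq 2$ and $n\geq 2$ be integers, let $T_m$ be a tree of order $m$ and let $H_n$ be a connected graph of order $n$. Then $rvc(T_m \diamond H_n)= rvc(T_m)$.
   Context: All graphs are finite, simple, connected and undirected. For $k\in\mathbb{N}$, a rainbow vertex $k$-coloring of $G$ is a function $c: V(G)\to\{1,\dots,k\}$ such that every two vertices $u,v$ are joined by a $u$–$v$ path whose internal vertices have pairwise distinct colors; $rvc(G)$ is the smallest positive integer $k$ for which $G$ has a rainbow vertex $k$-coloring. The edge corona $G\diamond H$ is obtained from one copy of $G$ and $|E(G)|$ copies of $H$, where, enumerating the edges of $G$ as $e_1,\dots,e_{|E(G)|}$, both end vertices of $e_j$ are joined to every vertex of the $j$-th copy of $H$. -}

module Defs where

open import Data.Nat using (ℕ; zero; suc; _+_; _≤_; _<_)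
open import Data.Fin using (Fin; zero; suc; toℕ; fromℕ; inject₁; _≟_)
open import Data.Bool using (Bool; true; false; T; _∧_; _∨_)
open import Data.Sum using (_⊎_; inj₁; inj₂)
open import Data.Product using (Σ; Σ-syntax; _×_; _,_)
open import Data.Empty using (⊥)
open import Relation.Nullary using (¬_)
open import Relation.Nullary.Decidable using (⌊_⌋)
open import Relation.Binary.PropositionalEquality using (_≡_)

AdjRel : Set → Set
AdjRel V = V → V → Bool

Edge : {V : Set} → AdjRel V → V → V → Set
Edge G u v = T (G u v)

IsSimple : {V : Set} → AdjRel V → Set
IsSimple {V} G = (∀ u v → G u v ≡ G v u) × (∀ v → ¬ Edge G v v)

record Path {V : Set} (G : AdjRel V) (u v : V) : Set where
  field
    len    : ℕ
    vtx    : Fin (suc len) → V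
    start  : vtx zero ≡ u
    end    : vtx (fromℕ len) ≡ v
    adj    : ∀ (i : Fin len) → Edge G (vtx (inject₁ i)) (vtx (suc i))
    distinct : ∀ i j → vtx i ≡ vtx j → i ≡ j

Internal : ℕ → {len : ℕ} → Fin (suc len) → Set
Internal len i = (0 < toℕ i) × (toℕ i < len)

RainbowPath : {V : Set} {G : AdjRel V} {u v : V} {k : ℕ} →
              (V → Fin k) → Path G u v → Set
RainbowPath c p = ∀ i j → Internal len i → Internal len j →
                  c (vtx i) ≡ c (vtx j) → i ≡ j
  where open Path p

Connected : {V : Set} → AdjRel V → Set
Connected {V} G = ∀ (u v : V) → Path G u v

record Cycle {V : Set} (G : AdjRel V) : Set where
  field
    j      : ℕ
    vtx    : Fin (3 + j) → V
    adj    : ∀ (i : Fin (2 + j)) → Edge G (vtx (inject₁ i)) (vtx (suc i))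
    close  : Edge G (vtx (fromℕ (2 + j))) (vtx zero)
    distinct : ∀ a b → vtx a ≡ vtx b → a ≡ b

Acyclic : {V : Set} → AdjRel V → Set
Acyclic G = ¬ Cycle G

IsTree : {V : Set} → AdjRel V → Set
IsTree G = Connected G × Acyclic G

IsRainbowVertexColoring : {V : Set} → AdjRel V → (k : ℕ) → (V → Fin k) → Set
IsRainbowVertexColoring {V} G k c =
  ∀ (u v : V) → Σ[ p ∈ Path G u v ] RainbowPath c p

HasRVC : {V : Set} → AdjRel V → ℕ → Set
HasRVC {V} G k = Σ[ c ∈ (V → Fin k) ] IsRainbowVertexColoring G k c

RVCIs : {V : Set} → AdjRel V → ℕ → Set
RVCIs G k = (1 ≤ k) × HasRVC G k × (∀ j → 1 ≤ j → HasRVC G j → k ≤ j)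

EdgeOf : {m : ℕ} → AdjRel (Fin m) → Set
EdgeOf {m} G = Σ[ a ∈ Fin m ] Σ[ b ∈ Fin m ] (toℕ a < toℕ b) × Edge G a b

-- Edge corona G ⋄ H: a copy of G plus one copy of H per edge e of G,
-- every vertex of copy e joined to both end vertices of e.
CoronaV : (m n : ℕ) → AdjRel (Fin m) → Set
CoronaV m n G = Fin m ⊎ (EdgeOf G × Fin n)

edgeCorona : {m n : ℕ} (G : AdjRel (Fin m)) (H : AdjRel (Fin n)) →
             AdjRel (CoronaV m n G)
edgeCorona G H (inj₁ u) (inj₁ v) = G u v
edgeCorona G H (inj₁ u) (inj₂ ((a , b , _) , h)) = ⌊ u ≟ a ⌋ ∨ ⌊ u ≟ b ⌋
edgeCorona G H (inj₂ ((a , b , _) , h)) (inj₁ u) = ⌊ u ≟ a ⌋ ∨ ⌊ u ≟ b ⌋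
edgeCorona G H (inj₂ ((a , b , _) , h)) (inj₂ ((a' , b' , _) , h')) =
  ⌊ a ≟ a' ⌋ ∧ ⌊ b ≟ b' ⌋ ∧ H h h'

{-# OPTIONS --safe #-}
-- A rainbow path of T ⋄ H between vertices of T enters the copy of H on an edge xy from x or y
-- and leaves it towards x or y; replacing each such excursion by the edge xy (or dropping it) and
-- shortcutting gives a path of T whose interior vertices are interior vertices of the original
-- path, so a rainbow colouring of T ⋄ H restricts to one of T.
-- Conversely, a path of a tree is determined by its ends, so under a rainbow colouring c of T every
-- path of T is rainbow. Colour each vertex of a copy of H arbitrarily: it is joined to the rest of
-- T ⋄ H by a path of T that starts with the edge carrying the copy, with the outer end of that edge
-- replaced by the vertex. So any two vertices are joined by a walk whose interior vertices are those
-- of a path of T, or a single vertex of T.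

module Submission where

open import Defs
open import Data.Nat using (ℕ; zero; suc; _≤_; _<_; z≤n; s≤s)
open import Data.Nat.Properties using (<⇒≢; <-irrelevant; <-asym)
open import Data.Fin as Fin using (Fin; zero; suc; toℕ; fromℕ; inject₁)
open import Data.Fin.Properties using (toℕ-fromℕ; ≤fromℕ; ≤∧≢⇒<)
open import Data.List using (List; []; _∷_; _++_; tabulate)
open import Data.List.Membership.Propositional using (_∈_; _∉_)
open import Data.List.Membership.Propositional.Properties using (∈-tabulate⁻; ∈-++⁻; ∈-++⁺ˡ)
open import Data.List.Membership.DecPropositional using (_∈?_)
open import Data.List.Relation.Unary.Any using (here; there)
open import Data.List.Relation.Unary.All as All using ([]; _∷_)
open import Data.List.Relation.Unary.All.Properties using (¬Any⇒All¬; anti-mono)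
open import Data.List.Relation.Unary.Unique.Propositional using (Unique; []; _∷_)
open import Data.List.Relation.Unary.Unique.Propositional.Properties as Unique
  using (tabulate⁺; Unique[x∷xs]⇒x∉xs)
open import Data.List.Relation.Binary.Subset.Propositional using (_⊆_)
open import Data.Product using (Σ-syntax; ∃-syntax; _×_; _,_; proj₁; proj₂; map₁; map₂)
open import Data.Sum as ⊎ using (_⊎_; inj₁; inj₂; [_,_]′)
import Data.Sum.Properties as ⊎
import Data.Product.Properties as Σ
open import Data.Bool using (T)
open import Data.Bool.Properties using (T-irrelevant; T-∨; T-∧)
open import Data.Empty using (⊥-elim)
open import Function using (_∘_; id)
open import Relation.Binary.Construct.Closure.ReflexiveTransitive
  using (Star; ε; _◅_; _◅◅_; revApp; reverse; gmap)
open import Relation.Binary.Definitions using (DecidableEquality)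
open import Relation.Binary.PropositionalEquality
  using (_≡_; _≢_; refl; sym; trans; cong; cong₂; subst)
open import Relation.Nullary using (¬_; yes; no)
open import Relation.Nullary.Decidable using (⌊_⌋; toWitness; fromWitness)
open import Function.Bundles using (module Equivalence)

≢0∧≢fromℕ⇒Internal : ∀ {n} (i : Fin (suc n)) → i ≢ zero → i ≢ fromℕ n → Internal n i
≢0∧≢fromℕ⇒Internal zero    i≢0 _   = ⊥-elim (i≢0 refl)
≢0∧≢fromℕ⇒Internal (suc i) _   i≢n =
  s≤s z≤n , subst (toℕ (suc i) <_) (toℕ-fromℕ _) (≤∧≢⇒< (≤fromℕ (suc i)) i≢n)

Walk : {V : Set} → AdjRel V → V → V → Set
Walk G = Star (Edge G)

module _ {V : Set} {G : AdjRel V} where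

  verts : ∀ {u v} → Walk G u v → List V
  verts {u} ε       = u ∷ []
  verts {u} (_ ◅ w) = u ∷ verts w

  start-∈ : ∀ {u v} (w : Walk G u v) → u ∈ verts w
  start-∈ ε       = here refl
  start-∈ (_ ◅ _) = here refl

  end-∈ : ∀ {u v} (w : Walk G u v) → v ∈ verts w
  end-∈ ε       = here refl
  end-∈ (_ ◅ w) = there (end-∈ w)

  Interior : ∀ {u v} → Walk G u v → V → Set
  Interior {u} {v} w z = z ∈ verts w × z ≢ u × z ≢ v

  -- Injectivity on the vertices other than the ends: this survives shortcutting a walk to a path.
  Rainbow : ∀ {k} → (V → Fin k) → ∀ {u v} → Walk G u v → Set
  Rainbow c w = ∀ {x y} → Interior w x → Interior w y → c x ≡ c y → x ≡ y

  rainbow-⊆ : ∀ {k} {c : V → Fin k} {u v s t} {q : Walk G u v} {w : Walk G s t} →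
              (∀ {z} → Interior q z → Interior w z) → Rainbow c w → Rainbow c q
  rainbow-⊆ q⊆w rw x∈q y∈q = rw (q⊆w x∈q) (q⊆w y∈q)

  length : ∀ {u v} → Walk G u v → ℕ
  length ε       = 0
  length (_ ◅ w) = suc (length w)

  vertex : ∀ {u v} (w : Walk G u v) → Fin (suc (length w)) → V
  vertex {u} ε       _       = u
  vertex {u} (_ ◅ _) zero    = u
  vertex     (_ ◅ w) (suc i) = vertex w i

  vertex-zero : ∀ {u v} (w : Walk G u v) → vertex w zero ≡ u
  vertex-zero ε       = refl
  vertex-zero (_ ◅ _) = refl

  vertex-last : ∀ {u v} (w : Walk G u v) → vertex w (fromℕ (length w)) ≡ v
  vertex-last ε       = refl
  vertex-last (_ ◅ w) = vertex-last w

  vertex-adj : ∀ {u v} (w : Walk G u v) (i : Fin (length w)) →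
               Edge G (vertex w (inject₁ i)) (vertex w (suc i))
  vertex-adj (e ◅ w) zero    = subst (Edge G _) (sym (vertex-zero w)) e
  vertex-adj (_ ◅ w) (suc i) = vertex-adj w i

  vertex-∈ : ∀ {u v} (w : Walk G u v) i → vertex w i ∈ verts w
  vertex-∈ ε       _       = here refl
  vertex-∈ (_ ◅ _) zero    = here refl
  vertex-∈ (_ ◅ w) (suc i) = there (vertex-∈ w i)

  vertex-injective : ∀ {u v} (w : Walk G u v) → Unique (verts w) →
                     ∀ {i j} → vertex w i ≡ vertex w j → i ≡ j
  vertex-injective ε       _         {zero}  {zero}  _  = refl
  vertex-injective (_ ◅ _) _         {zero}  {zero}  _  = refl
  vertex-injective (_ ◅ w) (u∉w ∷ _) {zero}  {suc j} eq = ⊥-elim (All.lookup u∉w (vertex-∈ w j) eq)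
  vertex-injective (_ ◅ w) (u∉w ∷ _) {suc i} {zero}  eq =
    ⊥-elim (All.lookup u∉w (vertex-∈ w i) (sym eq))
  vertex-injective (_ ◅ w) (_ ∷ uqw) {suc i} {suc j} eq = cong suc (vertex-injective w uqw eq)

  toPath : ∀ {u v} (w : Walk G u v) → Unique (verts w) → Path G u v
  toPath w uq = record
    { len = length w ; vtx = vertex w ; start = vertex-zero w ; end = vertex-last w
    ; adj = vertex-adj w ; distinct = λ _ _ → vertex-injective w uq }

  vertex-interior : ∀ {u v} (w : Walk G u v) → Unique (verts w) →
                    ∀ {i} → Internal (length w) i → Interior w (vertex w i)
  vertex-interior {u} {v} w uq {i} (0<i , i<len) = vertex-∈ w i , ≢first , ≢last
    where
    ≢first : vertex w i ≢ u
    ≢first eq = <⇒≢ 0<i (sym (cong toℕ (vertex-injective w uq (trans eq (sym (vertex-zero w))))))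
    ≢last : vertex w i ≢ v
    ≢last eq = <⇒≢ i<len (trans (cong toℕ (vertex-injective w uq (trans eq (sym (vertex-last w)))))
                                (toℕ-fromℕ (length w)))

  toPath-rainbow : ∀ {k} {c : V → Fin k} {u v} (w : Walk G u v) (uq : Unique (verts w)) →
                   Rainbow c w → RainbowPath c (toPath w uq)
  toPath-rainbow w uq rw i j i-int j-int eq =
    vertex-injective w uq (rw (vertex-interior w uq i-int) (vertex-interior w uq j-int) eq)

  tabulateWalk : ∀ n (f : Fin (suc n) → V) → (∀ i → Edge G (f (inject₁ i)) (f (suc i))) →
                 Walk G (f zero) (f (fromℕ n))
  tabulateWalk zero    f adj = ε
  tabulateWalk (suc n) f adj = adj zero ◅ tabulateWalk n (f ∘ suc) (adj ∘ suc)

  verts-tabulateWalk : ∀ n f adj → verts (tabulateWalk n f adj) ≡ tabulate f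
  verts-tabulateWalk zero    f adj = refl
  verts-tabulateWalk (suc n) f adj = cong (f zero ∷_) (verts-tabulateWalk n (f ∘ suc) (adj ∘ suc))

  walk : ∀ {u v} → Path G u v → Walk G u v
  walk record { len = n ; vtx = f ; start = refl ; end = refl ; adj = adj } = tabulateWalk n f adj

  walk-isPath : ∀ {u v} (p : Path G u v) → Unique (verts (walk p))
  walk-isPath record { len = n ; vtx = f ; start = refl ; end = refl ; adj = adj ; distinct = d } =
    subst Unique (sym (verts-tabulateWalk n f adj)) (tabulate⁺ (d _ _))

  tabulateWalk-interior : ∀ n f adj {z} → Interior (tabulateWalk n f adj) z →
                          ∃[ i ] z ≡ f i × Internal n i
  tabulateWalk-interior n f adj (z∈ , z≢first , z≢last)
    with ∈-tabulate⁻ {f = f} (subst (_ ∈_) (verts-tabulateWalk n f adj) z∈)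
  ... | i , refl = i , refl , ≢0∧≢fromℕ⇒Internal i (z≢first ∘ cong f) (z≢last ∘ cong f)

  walk-rainbow : ∀ {k} {c : V → Fin k} {u v} (p : Path G u v) → RainbowPath c p → Rainbow c (walk p)
  walk-rainbow record { len = n ; vtx = f ; start = refl ; end = refl ; adj = adj } rp x∈ y∈ eq
    with tabulateWalk-interior n f adj x∈ | tabulateWalk-interior n f adj y∈
  ... | i , refl , i-int | j , refl , j-int = cong f (rp i j i-int j-int eq)

  verts-◅◅-last : ∀ {u v x} (w : Walk G u v) (e : Edge G v x) →
                  verts (w ◅◅ e ◅ ε) ≡ verts w ++ x ∷ []
  verts-◅◅-last ε       e = refl
  verts-◅◅-last (_ ◅ w) e = cong (_ ∷_) (verts-◅◅-last w e)

  ◅◅-last-isPath : ∀ {u v x} (w : Walk G u v) (e : Edge G v x) →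
                   Unique (verts w) → x ∉ verts w → Unique (verts (w ◅◅ e ◅ ε))
  ◅◅-last-isPath w e uq x∉w = subst Unique (sym (verts-◅◅-last w e))
    (Unique.++⁺ uq ([] ∷ []) λ { (x∈w , here refl) → x∉w x∈w })

  ∈-verts-reverse : (sym-edge : ∀ {x y} → Edge G x y → Edge G y x) →
                    ∀ {u v z} (w : Walk G u v) → z ∈ verts (reverse sym-edge w) → z ∈ verts w
  ∈-verts-reverse sym-edge w = [ id , (λ { (here refl) → start-∈ w }) ]′ ∘ revApp⁻ w ε
    where
    revApp⁻ : ∀ {u v x z} (w : Walk G u v) (acc : Walk G u x) →
              z ∈ verts (revApp sym-edge w acc) → z ∈ verts w ⊎ z ∈ verts acc
    revApp⁻ ε       acc z∈ = inj₂ z∈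
    revApp⁻ (e ◅ w) acc z∈ with revApp⁻ w (sym-edge e ◅ acc) z∈
    ... | inj₁ z∈w           = inj₁ (there z∈w)
    ... | inj₂ (here refl)   = inj₁ (there (start-∈ w))
    ... | inj₂ (there z∈acc) = inj₂ z∈acc

  rainbow-reverse : ∀ {k} {c : V → Fin k} (sym-edge : ∀ {x y} → Edge G x y → Edge G y x) →
                    ∀ {u v} → Σ[ w ∈ Walk G u v ] Rainbow c w → Σ[ w ∈ Walk G v u ] Rainbow c w
  rainbow-reverse sym-edge (w , rw) =
    reverse sym-edge w ,
    rainbow-⊆ (λ (z∈ , z≢v , z≢u) → ∈-verts-reverse sym-edge w z∈ , z≢u , z≢v) rw

  rainbow-single : ∀ {k} {c : V → Fin k} {u v o} {w : Walk G u v} →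
                   (∀ {z} → Interior w z → z ≡ o) → Rainbow c w
  rainbow-single only-o x∈ y∈ _ = trans (only-o x∈) (sym (only-o y∈))

  prefix : ∀ {u v z} (w : Walk G u v) → z ∈ verts w → Σ[ p ∈ Walk G u z ] verts p ⊆ verts w
  prefix ε       (here refl) = ε , id
  prefix (_ ◅ _) (here refl) = ε , λ { (here refl) → here refl }
  prefix (e ◅ w) (there z∈w) with prefix w z∈w
  ... | p , p⊆w = e ◅ p , λ { (here refl) → here refl ; (there x∈p) → there (p⊆w x∈p) }

  suffix : ∀ {u v z} (w : Walk G u v) → z ∈ verts w → Unique (verts w) →
           Σ[ s ∈ Walk G z v ] Unique (verts s) × verts s ⊆ verts w
  suffix ε       (here refl) uq       = ε , uq , id
  suffix (e ◅ w) (here refl) uq       = e ◅ w , uq , id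
  suffix (_ ◅ w) (there z∈w) (_ ∷ uq) with suffix w z∈w uq
  ... | s , uqs , s⊆w = s , uqs , there ∘ s⊆w

  module _ (_≟_ : DecidableEquality V) where

    shortcut : ∀ {u v} (w : Walk G u v) → Σ[ p ∈ Walk G u v ] Unique (verts p) × verts p ⊆ verts w
    shortcut ε = ε , [] ∷ [] , id
    shortcut {u} (e ◅ w) with shortcut w
    ... | p , uq , p⊆w with _∈?_ _≟_ u (verts p)
    ...   | yes u∈p = let s , uqs , s⊆p = suffix p u∈p uq in s , uqs , there ∘ p⊆w ∘ s⊆p
    ...   | no u∉p  = e ◅ p , ¬Any⇒All¬ _ u∉p ∷ uq ,
                      λ { (here refl) → here refl ; (there x∈p) → there (p⊆w x∈p) }

    rainbowWalks⇒coloring : ∀ {k} {c : V → Fin k} → (∀ u v → Σ[ w ∈ Walk G u v ] Rainbow c w) →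
                            IsRainbowVertexColoring G k c
    rainbowWalks⇒coloring walks u v =
      let w , rw = walks u v
          p , uq , p⊆w = shortcut w
      in toPath p uq , toPath-rainbow p uq (rainbow-⊆ (map₁ p⊆w) rw)

module _ {V V′ : Set} {G : AdjRel V} {G′ : AdjRel V′} {f : V → V′} {k} {C : V′ → Fin k} where

  rainbow-pullback : (∀ {x y} → f x ≡ f y → x ≡ y) →
                     ∀ {u v s t} {q : Walk G u v} {w : Walk G′ s t} →
                     (∀ {z} → Interior q z → Interior w (f z)) → Rainbow C w → Rainbow (C ∘ f) q
  rainbow-pullback f-injective q⇒w rw x∈q y∈q eq = f-injective (rw (q⇒w x∈q) (q⇒w y∈q) eq)

  rainbow-pushforward : ∀ {u v s t} {p : Walk G u v} {w : Walk G′ s t} →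
                        (∀ {z} → Interior w z → ∃[ z′ ] z ≡ f z′ × Interior p z′) →
                        Rainbow (C ∘ f) p → Rainbow C w
  rainbow-pushforward w⇒p rp x∈w y∈w eq with w⇒p x∈w | w⇒p y∈w
  ... | _ , refl , x∈p | _ , refl , y∈p = cong f (rp x∈p y∈p eq)

module SimpleGraph {V : Set} {G : AdjRel V} (simple : IsSimple G) where

  sym-edge : ∀ {x y} → Edge G x y → Edge G y x
  sym-edge {x} {y} = subst T (proj₁ simple x y)

  edge⇒≢ : ∀ {x y} → Edge G x y → x ≢ y
  edge⇒≢ e refl = proj₂ simple _ e

Joins : {V : Set} → V → V → V → V → Set
Joins a b y x = (y ≡ a × x ≡ b) ⊎ (y ≡ b × x ≡ a)

joins-same-pair : ∀ {V : Set} {a b a′ b′ y x : V} →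
                  Joins a b y x → Joins a′ b′ y x → Joins a b a′ b′
joins-same-pair (inj₁ (refl , refl)) (inj₁ (refl , refl)) = inj₁ (refl , refl)
joins-same-pair (inj₁ (refl , refl)) (inj₂ (refl , refl)) = inj₂ (refl , refl)
joins-same-pair (inj₂ (refl , refl)) (inj₁ (refl , refl)) = inj₂ (refl , refl)
joins-same-pair (inj₂ (refl , refl)) (inj₂ (refl , refl)) = inj₁ (refl , refl)

module Forest {V : Set} {G : AdjRel V} (simple : IsSimple G) (acyclic : Acyclic G)
              (_≟_ : DecidableEquality V) where

  open SimpleGraph simple

  adjacent-ends⇒single-edge : ∀ {u x v} (e : Edge G u x) (w : Walk G x v) →
                              Unique (verts (e ◅ w)) → Edge G v u → x ≡ v
  adjacent-ends⇒single-edge e ε        _  _  = refl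
  adjacent-ends⇒single-edge e (e′ ◅ w) uq vu = ⊥-elim (acyclic record
    { j        = length w
    ; vtx      = vertex c
    ; adj      = vertex-adj c
    ; close    = subst (λ z → Edge G z _) (sym (vertex-last c)) vu
    ; distinct = λ _ _ → vertex-injective c uq
    })
    where
    c : Walk G _ _
    c = e ◅ e′ ◅ w

  neighbour-on-path⇒second : ∀ {u x v b} (e : Edge G u x) (w : Walk G x v) →
                             Unique (verts (e ◅ w)) → Edge G u b → b ∈ verts w → x ≡ b
  neighbour-on-path⇒second e w (u∉w ∷ _) ub b∈w with prefix w b∈w
  ... | p , p⊆w with shortcut _≟_ p
  ... | q , uq , q⊆p =
    adjacent-ends⇒single-edge e q (anti-mono (p⊆w ∘ q⊆p) u∉w ∷ uq) (sym-edge ub)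

  paths-unique : ∀ {u v} (p q : Walk G u v) →
                 Unique (verts p) → Unique (verts q) → verts p ≡ verts q
  paths-unique ε       ε       _          _          = refl
  paths-unique ε       (_ ◅ q) _          (u∉q ∷ _)  = ⊥-elim (All.lookup u∉q (end-∈ q) refl)
  paths-unique (_ ◅ p) ε       (u∉p ∷ _)  _          = ⊥-elim (All.lookup u∉p (end-∈ p) refl)
  paths-unique {u} (_◅_ {j = x} ux p) (uy ◅ q) (u∉p ∷ uqp) uq@(u∉q ∷ uqq) with _∈?_ _≟_ x (verts q)
  ... | yes x∈q with neighbour-on-path⇒second uy q uq ux x∈q
  ...   | refl = cong (u ∷_) (paths-unique p q uqp uqq)
  paths-unique {u} (_◅_ {j = x} ux p) (uy ◅ q) (u∉p ∷ uqp) uq | no x∉q =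
    ⊥-elim (All.lookup u∉p (subst (u ∈_) (sym (paths-unique p (sym-edge ux ◅ uy ◅ q) uqp uq′))
                                   (there (here refl))) refl)
    where
    uq′ : Unique (verts (sym-edge ux ◅ uy ◅ q))
    uq′ = (edge⇒≢ (sym-edge ux) ∷ ¬Any⇒All¬ _ x∉q) ∷ uq

  record PathFromEdge (a b : V) {u} (R : Walk G a u) : Set where
    field
      first second : V
      joins        : Joins a b first second
      edge         : Edge G first second
      rest         : Walk G second u
      isPath       : Unique (verts (edge ◅ rest))
      rest⊆R       : verts rest ⊆ verts R

  pathFromEdge : ∀ {a b u} → Edge G a b → (R : Walk G a u) → Unique (verts R) → PathFromEdge a b R
  pathFromEdge {a} {b} ab ε uq = record
    { first = b ; second = a ; joins = inj₂ (refl , refl) ; edge = sym-edge ab ; rest = ε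
    ; isPath = (edge⇒≢ (sym-edge ab) ∷ []) ∷ uq ; rest⊆R = id }
  pathFromEdge {a} {b} ab (_◅_ {j = x} ax R) uq with x ≟ b
  ... | yes refl = record
    { first = a ; second = x ; joins = inj₁ (refl , refl) ; edge = ax ; rest = R
    ; isPath = uq ; rest⊆R = there }
  ... | no x≢b = record
    { first = b ; second = a ; joins = inj₂ (refl , refl) ; edge = sym-edge ab ; rest = ax ◅ R
    ; isPath = (edge⇒≢ (sym-edge ab) ∷ ¬Any⇒All¬ _ (x≢b ∘ neighbour-on-path⇒second ax R uq ab)) ∷ uq
    ; rest⊆R = id }

  record PathBetweenEdges (a b a′ b′ : V) : Set where
    field
      first second second′ first′ : V
      joins         : Joins a b first second
      joins′        : Joins a′ b′ first′ second′
      edge          : Edge G first second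
      edge′         : Edge G second′ first′
      middle        : Walk G second second′
      first∉middle  : first ∉ verts middle
      first′∉middle : first′ ∉ verts middle
      isPath        : Unique (verts (edge ◅ middle ◅◅ edge′ ◅ ε))

  pathBetweenEdges : ∀ {a b a′ b′} → Edge G a b → Edge G a′ b′ → ¬ Joins a b a′ b′ →
                     (R : Walk G a′ a) → Unique (verts R) → PathBetweenEdges a b a′ b′
  pathBetweenEdges ab a′b′ different R uqR with pathFromEdge a′b′ R uqR
  ... | P′ with shortcut _≟_ (reverse sym-edge (PathFromEdge.rest P′))
  ... | M , uqM , M⊆ = record
    { first = first ; second = second ; second′ = second′ ; first′ = first′
    ; joins = joins ; joins′ = joins′ ; edge = edge ; edge′ = sym-edge edge′ ; middle = rest
    ; first∉middle = Unique[x∷xs]⇒x∉xs isPath ; first′∉middle = first′∉rest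
    ; isPath = ◅◅-last-isPath (edge ◅ rest) (sym-edge edge′) isPath
                 λ { (here first′≡first) → first≢first′ (sym first′≡first)
                   ; (there first′∈rest) → first′∉rest first′∈rest } }
    where
    open PathFromEdge P′ using () renaming
      (first to first′; second to second′; joins to joins′; edge to edge′; rest to rest′;
       isPath to isPath′)
    open PathFromEdge (pathFromEdge ab M uqM)
    first′∉rest : first′ ∉ verts rest
    first′∉rest = Unique[x∷xs]⇒x∉xs isPath′ ∘ ∈-verts-reverse sym-edge rest′ ∘ M⊆ ∘ rest⊆R
    first≢first′ : first ≢ first′
    first≢first′ refl = different (joins-same-pair joins (subst (Joins _ _ first) second′≡second joins′))
      where
      second′≡second : second′ ≡ second
      second′≡second = sym (adjacent-ends⇒single-edge edge rest isPath (sym-edge edge′))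

module Corona {m n : ℕ} (G : AdjRel (Fin m)) (simpleG : IsSimple G) (acyclicG : Acyclic G)
              (H : AdjRel (Fin n)) (simpleH : IsSimple H) where

  open SimpleGraph simpleG
  open SimpleGraph simpleH using () renaming (sym-edge to sym-edgeH)
  open Forest simpleG acyclicG Fin._≟_

  G⋄H : AdjRel (CoronaV m n G)
  G⋄H = edgeCorona G H

  _∈ₑ_ : Fin m → EdgeOf G → Set
  x ∈ₑ (a , b , _) = x ≡ a ⊎ x ≡ b

  edgeOf-≡ : ∀ {E E′ : EdgeOf G} → proj₁ E ≡ proj₁ E′ → proj₁ (proj₂ E) ≡ proj₁ (proj₂ E′) → E ≡ E′
  edgeOf-≡ {_ , _ , a<b , ab} {_ , _ , a<b′ , ab′} refl refl =
    cong₂ (λ a<b ab → _ , _ , a<b , ab) (<-irrelevant a<b a<b′) (T-irrelevant ab ab′)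

  _≟ₑ_ : DecidableEquality (EdgeOf G)
  _≟ₑ_ = Σ.≡-dec Fin._≟_ (Σ.≡-dec Fin._≟_ (Σ.≡-dec (λ p q → yes (<-irrelevant p q))
                                                    (λ p q → yes (T-irrelevant p q))))

  _≟ᵥ_ : DecidableEquality (CoronaV m n G)
  _≟ᵥ_ = ⊎.≡-dec Fin._≟_ (Σ.≡-dec _≟ₑ_ Fin._≟_)

  ≟⇒≡ : ∀ {x y : Fin m} → T ⌊ x Fin.≟ y ⌋ → x ≡ y
  ≟⇒≡ {x} {y} = toWitness {a? = x Fin.≟ y}

  ≡⇒≟ : ∀ {x y : Fin m} → x ≡ y → T ⌊ x Fin.≟ y ⌋
  ≡⇒≟ {x} {y} = fromWitness {a? = x Fin.≟ y}

  hang-adj : ∀ {x E h} → x ∈ₑ E → Edge G⋄H (inj₁ x) (inj₂ (E , h))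
  hang-adj = Equivalence.from T-∨ ∘ ⊎.map ≡⇒≟ ≡⇒≟

  hang-adj⁻ : ∀ {x E h} → Edge G⋄H (inj₁ x) (inj₂ (E , h)) → x ∈ₑ E
  hang-adj⁻ = ⊎.map ≟⇒≡ ≟⇒≡ ∘ Equivalence.to T-∨

  copy-adj : ∀ {E h E′ h′} → E ≡ E′ → Edge H h h′ → Edge G⋄H (inj₂ (E , h)) (inj₂ (E′ , h′))
  copy-adj {a , b , _} refl hh = Equivalence.from (T-∧ {⌊ a Fin.≟ a ⌋})
    (≡⇒≟ refl , Equivalence.from (T-∧ {⌊ b Fin.≟ b ⌋}) (≡⇒≟ refl , hh))

  copy-adj⁻ : ∀ {E h E′ h′} → Edge G⋄H (inj₂ (E , h)) (inj₂ (E′ , h′)) → E ≡ E′ × Edge H h h′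
  copy-adj⁻ e =
    let a≡a′ , e′ = Equivalence.to T-∧ e
        b≡b′ , hh = Equivalence.to T-∧ e′
    in edgeOf-≡ (≟⇒≡ a≡a′) (≟⇒≡ b≡b′) , hh

  sym-edge⋄ : ∀ {s t} → Edge G⋄H s t → Edge G⋄H t s
  sym-edge⋄ {inj₁ _} {inj₁ _} = sym-edge
  sym-edge⋄ {inj₁ _} {inj₂ _} = id
  sym-edge⋄ {inj₂ _} {inj₁ _} = id
  sym-edge⋄ {inj₂ (E , h)} {inj₂ (E′ , h′)} e =
    let E≡E′ , hh = copy-adj⁻ {E} {h} {E′} {h′} e in copy-adj (sym E≡E′) (sym-edgeH hh)

  endpoints-adjacent : ∀ {x y E} → x ∈ₑ E → y ∈ₑ E → x ≢ y → Edge G x y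
  endpoints-adjacent             (inj₁ refl) (inj₁ refl) x≢y = ⊥-elim (x≢y refl)
  endpoints-adjacent {E = _ , _ , _ , ab} (inj₁ refl) (inj₂ refl) _ = ab
  endpoints-adjacent {E = _ , _ , _ , ab} (inj₂ refl) (inj₁ refl) _ = sym-edge ab
  endpoints-adjacent             (inj₂ refl) (inj₂ refl) x≢y = ⊥-elim (x≢y refl)

  lift : ∀ {u v} → Walk G u v → Walk G⋄H (inj₁ u) (inj₁ v)
  lift = gmap inj₁ id

  ∈-lift⁻ : ∀ {u v z} (w : Walk G u v) → z ∈ verts (lift w) → ∃[ z′ ] z ≡ inj₁ z′ × z′ ∈ verts w
  ∈-lift⁻ ε       (here refl) = _ , refl , here refl
  ∈-lift⁻ (_ ◅ _) (here refl) = _ , refl , here refl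
  ∈-lift⁻ (_ ◅ w) (there z∈)  = map₂ (map₂ there) (∈-lift⁻ w z∈)

  Near : Fin m → CoronaV m n G → Set
  Near x (inj₁ u)       = x ≡ u
  Near x (inj₂ (E , _)) = x ∈ₑ E

  near-step : ∀ {x s t} → Near x s → Edge G⋄H s t → Near x t ⊎ ∃[ y ] t ≡ inj₁ y × Edge G x y
  near-step {s = inj₁ _} {inj₁ y} refl e = inj₂ (y , refl , e)
  near-step {s = inj₁ _} {inj₂ (E , h)} refl e = inj₁ (hang-adj⁻ {E = E} {h} e)
  near-step {x} {inj₂ (E , h)} {inj₁ y} x∈E e with x Fin.≟ y
  ... | yes x≡y = inj₁ x≡y
  ... | no  x≢y = inj₂ (y , refl , endpoints-adjacent {E = E} x∈E (hang-adj⁻ {E = E} {h} e) x≢y)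
  near-step {x} {inj₂ (E , h)} {inj₂ (E′ , h′)} x∈E e =
    inj₁ (subst (x ∈ₑ_) (proj₁ (copy-adj⁻ {E} {h} {E′} {h′} e)) x∈E)

  project : ∀ {x s v} → Near x s → (w : Walk G⋄H s (inj₁ v)) →
            Σ[ q ∈ Walk G x v ] (∀ {z} → z ∈ verts q → z ≡ x ⊎ inj₁ z ∈ verts w)
  project refl ε = ε , λ { (here refl) → inj₁ refl }
  project near (e ◅ w) with near-step near e
  ... | inj₁ near′ = let q , q⊆w = project near′ w in q , ⊎.map₂ there ∘ q⊆w
  ... | inj₂ (y , refl , xy) = let q , q⊆w = project refl w in
    xy ◅ q , λ { (here refl) → inj₁ refl
               ; (there z∈q) → inj₂ (there ([ (λ { refl → start-∈ w }) , id ]′ (q⊆w z∈q))) }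

  corona⇒tree : ∀ {k} → HasRVC G⋄H k → HasRVC G k
  corona⇒tree (C , rC) = C ∘ inj₁ , rainbowWalks⇒coloring Fin._≟_ walks
    where
    walks : ∀ u v → Σ[ q ∈ Walk G u v ] Rainbow (C ∘ inj₁) q
    walks u v with rC (inj₁ u) (inj₁ v)
    ... | P , rP with project refl (walk P)
    ... | q , q⊆P = q , rainbow-pullback {C = C} ⊎.inj₁-injective interior (walk-rainbow P rP)
      where
      interior : ∀ {z} → Interior q z → Interior (walk P) (inj₁ z)
      interior (z∈q , z≢u , z≢v) =
        [ ⊥-elim ∘ z≢u , id ]′ (q⊆P z∈q) , z≢u ∘ ⊎.inj₁-injective , z≢v ∘ ⊎.inj₁-injective

  interior-lift : ∀ {u v z} (p : Walk G u v) →
                  Interior (lift p) z → ∃[ z′ ] z ≡ inj₁ z′ × Interior p z′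
  interior-lift p (z∈ , z≢u , z≢v) with ∈-lift⁻ p z∈
  ... | z′ , refl , z′∈ = z′ , refl , z′∈ , z≢u ∘ cong inj₁ , z≢v ∘ cong inj₁

  joins⇒∈ₑ : ∀ {E : EdgeOf G} {y x} → Joins (proj₁ E) (proj₁ (proj₂ E)) y x → x ∈ₑ E
  joins⇒∈ₑ (inj₁ (_ , x≡b)) = inj₂ x≡b
  joins⇒∈ₑ (inj₂ (_ , x≡a)) = inj₁ x≡a

  joins⇒≡ : ∀ {E E′ : EdgeOf G} → Joins (proj₁ E) (proj₁ (proj₂ E)) (proj₁ E′) (proj₁ (proj₂ E′)) →
            E ≡ E′
  joins⇒≡ {_ , _ , _ , _}   {_ , _ , _ , _}   (inj₁ (refl , refl)) = edgeOf-≡ refl refl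
  joins⇒≡ {_ , _ , a<b , _} {_ , _ , b<a , _} (inj₂ (refl , refl)) = ⊥-elim (<-asym a<b b<a)

  -- Vertices of the copies of H are never interior on the walks built below; their colour is arbitrary.
  extend : ∀ {k} → (Fin m → Fin k) → CoronaV m n G → Fin k
  extend c (inj₁ u)             = c u
  extend c (inj₂ ((a , _) , _)) = c a

  module _ {k} (c : Fin m → Fin k) (rc : IsRainbowVertexColoring G k c) where

    treePath : ∀ u v → Σ[ p ∈ Walk G u v ] Unique (verts p)
    treePath u v = walk (proj₁ (rc u v)) , walk-isPath (proj₁ (rc u v))

    path-rainbow : ∀ {u v} (p : Walk G u v) → Unique (verts p) → Rainbow c p
    path-rainbow {u} {v} p uq with rc u v
    ... | P , rP = rainbow-⊆ (map₁ (subst (_ ∈_) (paths-unique p (walk P) uq (walk-isPath P))))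
                             (walk-rainbow P rP)

    tree-walk : ∀ u v → Σ[ w ∈ Walk G⋄H (inj₁ u) (inj₁ v) ] Rainbow (extend c) w
    tree-walk u v with treePath u v
    ... | p , uq = lift p , rainbow-pushforward (interior-lift p) (path-rainbow p uq)

    hanging-walk : ∀ E h u → Σ[ w ∈ Walk G⋄H (inj₂ (E , h)) (inj₁ u) ] Rainbow (extend c) w
    hanging-walk E@(a , _ , _ , ab) h u with treePath a u
    ... | R , uqR =
      w , rainbow-pushforward {p = edge ◅ rest} {w} interior (path-rainbow (edge ◅ rest) isPath)
      where
      open PathFromEdge (pathFromEdge ab R uqR)
      w : Walk G⋄H (inj₂ (E , h)) (inj₁ u)
      w = hang-adj {E = E} {h} (joins⇒∈ₑ {E} joins) ◅ lift rest
      interior : ∀ {z} → Interior w z → ∃[ z′ ] z ≡ inj₁ z′ × Interior (edge ◅ rest) z′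
      interior (here refl , z≢s , _)  = ⊥-elim (z≢s refl)
      interior (there z∈ , _ , z≢u) with ∈-lift⁻ rest z∈
      ... | z′ , refl , z′∈ =
        z′ , refl , there z′∈ , (λ { refl → Unique[x∷xs]⇒x∉xs isPath z′∈ }) , z≢u ∘ cong inj₁

    bridge-walk : ∀ {E E′} → E ≢ E′ → ∀ h h′ →
                  Σ[ w ∈ Walk G⋄H (inj₂ (E , h)) (inj₂ (E′ , h′)) ] Rainbow (extend c) w
    bridge-walk {E@(a , _ , _ , ab)} {E′@(a′ , _ , _ , a′b′)} E≢E′ h h′ with treePath a′ a
    ... | R , uqR = w , rainbow-pushforward {p = p} {w} interior (path-rainbow p isPath)
      where
      open PathBetweenEdges (pathBetweenEdges ab a′b′ (E≢E′ ∘ joins⇒≡) R uqR)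
      p : Walk G first first′
      p = edge ◅ middle ◅◅ edge′ ◅ ε
      w : Walk G⋄H (inj₂ (E , h)) (inj₂ (E′ , h′))
      w = hang-adj {E = E} {h} (joins⇒∈ₑ {E} joins) ◅ lift middle ◅◅
          hang-adj {E = E′} {h′} (joins⇒∈ₑ {E′} joins′) ◅ ε
      interior : ∀ {z} → Interior w z → ∃[ z′ ] z ≡ inj₁ z′ × Interior p z′
      interior (here refl , z≢s , _) = ⊥-elim (z≢s refl)
      interior (there z∈ , _ , z≢t)
        with ∈-++⁻ (verts (lift middle)) (subst (_ ∈_) (verts-◅◅-last (lift middle) _) z∈)
      ... | inj₂ (here refl) = ⊥-elim (z≢t refl)
      ... | inj₁ z∈middle with ∈-lift⁻ middle z∈middle
      ...   | z′ , refl , z′∈ =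
        z′ , refl , there (subst (_ ∈_) (sym (verts-◅◅-last middle _)) (∈-++⁺ˡ z′∈)) ,
        (λ { refl → first∉middle z′∈ }) , (λ { refl → first′∉middle z′∈ })

    sibling-walk : ∀ E h h′ → Σ[ w ∈ Walk G⋄H (inj₂ (E , h)) (inj₂ (E , h′)) ] Rainbow (extend c) w
    sibling-walk E h h′ = w , rainbow-single {w = w} only-first-end
      where
      w : Walk G⋄H (inj₂ (E , h)) (inj₂ (E , h′))
      w = hang-adj {E = E} {h} (inj₁ refl) ◅ hang-adj {E = E} {h′} (inj₁ refl) ◅ ε
      only-first-end : ∀ {z} → Interior w z → z ≡ inj₁ (proj₁ E)
      only-first-end (here refl , z≢s , _)                 = ⊥-elim (z≢s refl)
      only-first-end (there (here refl) , _)               = refl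
      only-first-end (there (there (here refl)) , _ , z≢t) = ⊥-elim (z≢t refl)

    walks : ∀ s t → Σ[ w ∈ Walk G⋄H s t ] Rainbow (extend c) w
    walks (inj₁ u)       (inj₁ v)         = tree-walk u v
    walks (inj₂ (E , h)) (inj₁ u)         = hanging-walk E h u
    walks (inj₁ u)       (inj₂ (E , h))   =
      rainbow-reverse (λ {s} {t} → sym-edge⋄ {s} {t}) (hanging-walk E h u)
    walks (inj₂ (E , h)) (inj₂ (E′ , h′)) with E ≟ₑ E′
    ... | yes refl = sibling-walk E h h′
    ... | no  E≢E′ = bridge-walk E≢E′ h h′

  tree⇒corona : ∀ {k} → HasRVC G k → HasRVC G⋄H k
  tree⇒corona (c , rc) = extend c , rainbowWalks⇒coloring _≟ᵥ_ (walks c rc)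

RVCIs-transfer : ∀ {V V′ : Set} {G : AdjRel V} {G′ : AdjRel V′} {k} →
                 (∀ {j} → HasRVC G j → HasRVC G′ j) → (∀ {j} → HasRVC G′ j → HasRVC G j) →
                 RVCIs G k → RVCIs G′ k
RVCIs-transfer to from (1≤k , hasₖ , minimal) =
  1≤k , to hasₖ , λ j 1≤j hasⱼ → minimal j 1≤j (from hasⱼ)

mainTheorem5 : (m n : ℕ) → 2 ≤ m → 2 ≤ n →
    (T : AdjRel (Fin m)) → IsSimple T → IsTree T →
    (H : AdjRel (Fin n)) → IsSimple H → Connected H →
    (k : ℕ) → (RVCIs (edgeCorona T H) k → RVCIs T k) × (RVCIs T k → RVCIs (edgeCorona T H) k)
mainTheorem5 m n _ _ T simpleT (_ , acyclicT) H simpleH _ k =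
  RVCIs-transfer corona⇒tree tree⇒corona , RVCIs-transfer tree⇒corona corona⇒tree
  where open Corona T simpleT acyclicT H simpleH
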